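{- Let $p\ge3$, $n\ge0$ be integers. If $u,v$ are adjacent vertices of $H_p^n$ and either $o(u)=p$ or $o(v)=p$, then $\deg(u)=\deg(v)$.
   Context: For integers $p\ge 3$, $n\ge 0$, let $[p]_0=\{0,\dots,p-1\}$. The generalized Hanoi graph $H_p^n$ has vertex set $[p]_0^n$: a vertex $s=s_n\cdots s_1$ encodes a state of the Tower of Hanoi with $p$ pegs and $n$ discs of sizes $1<\dots<n$, disc $d$ lying on peg $s_d$. Two vertices are adjacent iff they have the form $\underline{s}\,i\,\overline{s}$ and $\underline{s}\,j\,\overline{s}$ with $i\ne j$, $\underline{s}\in[p]_0^{n-d}$, $\overline{s}\in([p]_0\setminus\{i,j\})^{d-1}$ for some $d$. The occupancy $o(s)$ is the number of pegs holding at least one disc in state $s$. -}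

module Defs where

open import Data.Nat using (ℕ; zero; suc)
open import Data.Fin using (Fin)
open import Data.Fin.Properties using (_≟_)
open import Data.Vec using (Vec; []; _∷_; allFin; toList)
open import Data.Vec.Relation.Unary.All using (All; all?)
open import Data.Vec.Relation.Unary.Any using (any?)
open import Data.List using (List; length; filter; map; cartesianProductWith; [_]; concatMap)
open import Data.Product using (_×_; _,_)
open import Data.Sum using (_⊎_; inj₁; inj₂)
open import Relation.Binary.PropositionalEquality using (_≡_; _≢_; refl; cong)
open import Relation.Nullary using (¬_; Dec; yes; no)
open import Relation.Nullary.Decidable using (_×-dec_; _⊎-dec_; ¬?)
open import Data.Vec.Properties using (∷-injective)

-- A state s = s_n ⋯ s_1 of the Tower of Hanoi with p pegs and n discs is
-- represented by a vector whose head is s_n (position of the largest disc)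
-- and whose last entry is s_1 (position of the smallest disc).
State : ℕ → ℕ → Set
State p n = Vec (Fin p) n

-- Adjacency in H_p^n:  s = u i w  and  t = u j w  with i ≢ j and every
-- entry of w (the smaller discs) different from both i and j.
-- Recursively on the common prefix u.
data Adj {p : ℕ} : {n : ℕ} → State p n → State p n → Set where
  here  : ∀ {n} {i j : Fin p} {w : State p n} →
          i ≢ j → All (λ c → c ≢ i × c ≢ j) w → Adj (i ∷ w) (j ∷ w)
  there : ∀ {n} {x : Fin p} {s t : State p n} → Adj s t → Adj (x ∷ s) (x ∷ t)

private
  _≟v_ : ∀ {p n} (s t : State p n) → Dec (s ≡ t)
  [] ≟v [] = yes refl
  (x ∷ s) ≟v (y ∷ t) with x ≟ y | s ≟v t
  ... | yes refl | yes refl = yes refl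
  ... | no x≢y | _ = no λ e → x≢y (Data.Product.proj₁ (∷-injective e))
  ... | yes _ | no s≢t = no λ e → s≢t (Data.Product.proj₂ (∷-injective e))

adj? : ∀ {p n} (s t : State p n) → Dec (Adj s t)
adj? [] [] = no λ ()
adj? (x ∷ s) (y ∷ t) with x ≟ y
... | yes refl with adj? s t
...   | yes a = yes (there a)
...   | no ¬a = no λ { (here x≢x _) → x≢x refl ; (there a) → ¬a a }
adj? (x ∷ s) (y ∷ t) | no x≢y with s ≟v t
... | no s≢t = no λ { (here _ _) → s≢t refl ; (there _) → x≢y refl }
... | yes refl with all? (λ c → ¬? (c ≟ x) ×-dec ¬? (c ≟ y)) s
...   | yes al = yes (here x≢y al)
...   | no ¬al = no λ { (here _ al) → ¬al al ; (there _) → x≢y refl }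

allStates : (p n : ℕ) → List (State p n)
allStates p zero = [ [] ]
allStates p (suc n) =
  concatMap (λ x → map (x ∷_) (allStates p n)) (toList (allFin p))

deg : ∀ {p n} → State p n → ℕ
deg {p} {n} s = length (filter (adj? s) (allStates p n))

occ : ∀ {p n} → State p n → ℕ
occ {p} s = length (filter (λ k → any? (k ≟_) s) (toList (allFin p)))

-- The degree of a state depends only on its occupancy.  Every unordered pair of
-- pegs of which at least one is nonempty allows exactly one move (of the smaller
-- of the two top discs), so a state occupying k pegs has degree
-- (p − 1) + (p − 2) + ⋯ + (p − k); recursively, the largest disc adds
-- p − 1 − o(w) moves exactly when it is alone on its peg.  One move changes the
-- occupancy by at most one, and the increments p − k vanish from k = p on, so
-- the degree does not change across an edge at a state occupying all p pegs.

module Submission where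

open import Defs
open import Data.Empty using (⊥-elim)
open import Data.Fin using (Fin) renaming (zero to fzero; suc to fsuc)
open import Data.Fin.Properties using (_≟_; suc-injective)
open import Data.List using (List; []; _∷_; length; filter; map; _++_; concatMap)
open import Data.List.Properties using (filter-≐; filter-none; filter-++; length-++)
open import Data.List.Relation.Unary.All using (universal)
open import Data.Nat using (ℕ; zero; suc; pred; _+_; _*_; _∸_; _≤_)
open import Data.Nat.Properties
  using (+-suc; +-identityʳ; *-identityʳ; m+n∸m≡n; pred[m∸n]≡m∸[1+n]; m≤n⇒m∸n≡0; n≤1+n; ≤-refl)
open import Data.Product using (_×_; _,_; proj₁; proj₂)
open import Data.Sum using (_⊎_; inj₁; inj₂; swap)
open import Data.Vec using (head; tail; toList; allFin) renaming ([] to []ᵥ; _∷_ to _∷ᵥ_; map to mapᵥ)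
open import Data.Vec.Properties using (≡-dec; allFin-map; toList-map; length-toList; ∷-injective)
open import Data.Vec.Membership.Propositional using (_∈_; _∉_)
open import Data.Vec.Relation.Unary.All using (All; all?) renaming ([] to []ᵃ; _∷_ to _∷ᵃ_)
open import Data.Vec.Relation.Unary.Any using (any?; here; there)
open import Function using (_∘_)
open import Relation.Binary.PropositionalEquality
  using (_≡_; _≢_; refl; sym; trans; cong; cong₂; subst₂; module ≡-Reasoning)
open import Relation.Nullary.Decidable using (yes; no; _×-dec_; ¬?)
open import Relation.Unary using (Decidable; Empty; _≐_; _⊥_)
open import Relation.Unary.Properties using (_∪?_; ∁?; ∅?)

private variable
  A B C : Set

count : {P : A → Set} → Decidable P → List A → ℕ
count P? xs = length (filter P? xs)

count-≐ : {P Q : A → Set} (P? : Decidable P) (Q? : Decidable Q) → P ≐ Q →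
          ∀ xs → count P? xs ≡ count Q? xs
count-≐ P? Q? P≐Q xs = cong length (filter-≐ P? Q? P≐Q xs)

count-empty : {P : A → Set} (P? : Decidable P) → Empty P → ∀ xs → count P? xs ≡ 0
count-empty P? ∅P xs = cong length (filter-none P? (universal ∅P xs))

count-∪ : {P Q : A → Set} (P? : Decidable P) (Q? : Decidable Q) → P ⊥ Q →
          ∀ xs → count (P? ∪? Q?) xs ≡ count P? xs + count Q? xs
count-∪ P? Q? P⊥Q [] = refl
count-∪ P? Q? P⊥Q (x ∷ xs) with P? x | Q? x | count-∪ P? Q? P⊥Q xs
... | yes px | yes qx | _  = ⊥-elim (P⊥Q (px , qx))
... | yes _  | no _   | ih = cong suc ih
... | no _   | yes _  | ih = trans (cong suc ih) (sym (+-suc _ _))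
... | no _   | no _   | ih = ih

count-∁ : {P : A → Set} (P? : Decidable P) →
          ∀ xs → count P? xs + count (∁? P?) xs ≡ length xs
count-∁ P? [] = refl
count-∁ P? (x ∷ xs) with P? x
... | yes _ = cong suc (count-∁ P? xs)
... | no _  = trans (+-suc _ _) (cong suc (count-∁ P? xs))

count-++ : {P : A → Set} (P? : Decidable P) →
           ∀ xs ys → count P? (xs ++ ys) ≡ count P? xs + count P? ys
count-++ P? xs ys = trans (cong length (filter-++ P? xs ys)) (length-++ (filter P? xs))

count-map : {P : B → Set} (P? : Decidable P) (f : A → B) →
            ∀ xs → count P? (map f xs) ≡ count (P? ∘ f) xs
count-map P? f [] = refl
count-map P? f (x ∷ xs) with P? (f x)
... | yes _ = cong suc (count-map P? f xs)
... | no _  = count-map P? f xs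

count-concatMap-map : {P : C → Set} {Q : A → Set} {R : B → Set}
  (P? : Decidable P) (Q? : Decidable Q) (R? : Decidable R) (f : A → B → C) →
  (∀ {x y} → P (f x y) → Q x × R y) → (∀ {x y} → Q x → R y → P (f x y)) →
  ∀ xs ys → count P? (concatMap (λ x → map (f x) ys) xs) ≡ count Q? xs * count R? ys
count-concatMap-map P? Q? R? f split join [] ys = refl
count-concatMap-map P? Q? R? f split join (x ∷ xs) ys with Q? x
... | yes qx = trans (count-++ P? (map (f x) ys) _)
  (cong₂ _+_ (trans (count-map P? (f x) ys) (count-≐ _ R? (proj₂ ∘ split , join qx) ys))
             (count-concatMap-map P? Q? R? f split join xs ys))
... | no ¬qx = trans (count-++ P? (map (f x) ys) _)
  (cong₂ _+_ (trans (count-map P? (f x) ys) (count-empty _ (λ y → ¬qx ∘ proj₁ ∘ split) ys))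
             (count-concatMap-map P? Q? R? f split join xs ys))

count-allFin-≡ : ∀ {m} (i : Fin m) → count (_≟ i) (toList (allFin m)) ≡ 1
count-allFin-≡ {suc m} i = begin
  count (_≟ i) (toList (allFin (suc m)))
    ≡⟨ cong (count (_≟ i) ∘ toList) (allFin-map m) ⟩
  count (_≟ i) (fzero ∷ toList (mapᵥ fsuc (allFin m)))
    ≡⟨ cong (count (_≟ i) ∘ (fzero ∷_)) (toList-map fsuc (allFin m)) ⟩
  count (_≟ i) (fzero ∷ map fsuc (toList (allFin m)))
    ≡⟨ shifted i ⟩
  1 ∎
  where
  open ≡-Reasoning
  js = toList (allFin m)
  shifted : ∀ i → count (_≟ i) (fzero ∷ map fsuc js) ≡ 1
  shifted fzero = cong suc (trans (count-map (_≟ fzero) fsuc js) (count-empty _ (λ _ ()) js))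
  shifted (fsuc i) = trans (count-map (_≟ fsuc i) fsuc js)
    (trans (count-≐ _ (_≟ i) (suc-injective , cong fsuc) js) (count-allFin-≡ i))

data WithinOne : ℕ → ℕ → Set where
  equal : ∀ {a} → WithinOne a a
  up    : ∀ {a} → WithinOne a (suc a)
  down  : ∀ {a} → WithinOne (suc a) a

withinOne-of-extensions : ∀ {a b c} → a ≡ c ⊎ a ≡ suc c → b ≡ c ⊎ b ≡ suc c → WithinOne a b
withinOne-of-extensions (inj₁ refl) (inj₁ refl) = equal
withinOne-of-extensions (inj₁ refl) (inj₂ refl) = up
withinOne-of-extensions (inj₂ refl) (inj₁ refl) = down
withinOne-of-extensions (inj₂ refl) (inj₂ refl) = equal

-- Beyond k = p the increments are 0 by truncated subtraction.
hanoiDegree : ℕ → ℕ → ℕ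
hanoiDegree p zero    = 0
hanoiDegree p (suc k) = hanoiDegree p k + (p ∸ suc k)

hanoiDegree-stable : ∀ p k → p ≤ suc k → hanoiDegree p (suc k) ≡ hanoiDegree p k
hanoiDegree-stable p k p≤1+k = trans (cong (hanoiDegree p k +_) (m≤n⇒m∸n≡0 p≤1+k)) (+-identityʳ _)

hanoiDegree-withinOne : ∀ {p a b} → WithinOne a b → a ≡ p ⊎ b ≡ p → hanoiDegree p a ≡ hanoiDegree p b
hanoiDegree-withinOne equal _ = refl
hanoiDegree-withinOne {p} up (inj₁ refl) = sym (hanoiDegree-stable p p (n≤1+n p))
hanoiDegree-withinOne {a = a} up (inj₂ refl) = sym (hanoiDegree-stable (suc a) a ≤-refl)
hanoiDegree-withinOne down a≡p⊎b≡p = sym (hanoiDegree-withinOne up (swap a≡p⊎b≡p))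

module _ {p : ℕ} where

  pegs : List (Fin p)
  pegs = toList (allFin p)

  occupied? : ∀ {n} (s : State p n) → Decidable (_∈ s)
  occupied? s k = any? (k ≟_) s

  occ-[] : occ {p} []ᵥ ≡ 0
  occ-[] = count-empty (occupied? []ᵥ) (λ _ ()) pegs

  occ-∷-∈ : ∀ {n x} {w : State p n} → x ∈ w → occ (x ∷ᵥ w) ≡ occ w
  occ-∷-∈ x∈w = count-≐ _ _ ((λ { (here refl) → x∈w ; (there k∈w) → k∈w }) , there) pegs

  occ-∷-∉ : ∀ {n x} {w : State p n} → x ∉ w → occ (x ∷ᵥ w) ≡ suc (occ w)
  occ-∷-∉ {x = x} {w} x∉w = begin
    occ (x ∷ᵥ w)
      ≡⟨ count-≐ (occupied? (x ∷ᵥ w)) ((_≟ x) ∪? occupied? w) (split , join) pegs ⟩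
    count ((_≟ x) ∪? occupied? w) pegs
      ≡⟨ count-∪ (_≟ x) (occupied? w) (λ { (refl , x∈w) → x∉w x∈w }) pegs ⟩
    count (_≟ x) pegs + occ w
      ≡⟨ cong (_+ occ w) (count-allFin-≡ x) ⟩
    suc (occ w) ∎
    where
    open ≡-Reasoning
    split : ∀ {k} → k ∈ x ∷ᵥ w → k ≡ x ⊎ k ∈ w
    split (here k≡x) = inj₁ k≡x
    split (there k∈w) = inj₂ k∈w
    join : ∀ {k} → k ≡ x ⊎ k ∈ w → k ∈ x ∷ᵥ w
    join (inj₁ k≡x) = here k≡x
    join (inj₂ k∈w) = there k∈w

  count-unoccupied : ∀ {n} (w : State p n) → count (∁? (occupied? w)) pegs ≡ p ∸ occ w
  count-unoccupied w = trans (sym (m+n∸m≡n (occ w) _))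
    (cong (_∸ occ w) (trans (count-∁ (occupied? w) pegs) (length-toList (allFin p))))

  Avoids : ∀ {n} → State p n → Fin p → Fin p → Set
  Avoids w x y = All (λ c → c ≢ x × c ≢ y) w

  avoids⇒∉ : ∀ {n x y} {w : State p n} → Avoids w x y → x ∉ w × y ∉ w
  avoids⇒∉ []ᵃ = (λ ()) , (λ ())
  avoids⇒∉ ((c≢x , c≢y) ∷ᵃ av) =
    (λ { (here x≡c) → c≢x (sym x≡c) ; (there x∈w) → proj₁ (avoids⇒∉ av) x∈w }) ,
    (λ { (here y≡c) → c≢y (sym y≡c) ; (there y∈w) → proj₂ (avoids⇒∉ av) y∈w })

  ∉⇒avoids : ∀ {n x y} {w : State p n} → x ∉ w → y ∉ w → Avoids w x y
  ∉⇒avoids {w = []ᵥ} x∉w y∉w = []ᵃ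
  ∉⇒avoids {w = c ∷ᵥ w} x∉w y∉w =
    (x∉w ∘ here ∘ sym , y∉w ∘ here ∘ sym) ∷ᵃ ∉⇒avoids (x∉w ∘ there) (y∉w ∘ there)

  LargestDiscMove : ∀ {n} → Fin p → State p n → Fin p → Set
  LargestDiscMove x w y = x ≢ y × Avoids w x y

  largestDiscMove? : ∀ {n} (x : Fin p) (w : State p n) → Decidable (LargestDiscMove x w)
  largestDiscMove? x w y = ¬? (x ≟ y) ×-dec all? (λ c → ¬? (c ≟ x) ×-dec ¬? (c ≟ y)) w

  largestDiscMoves-∈ : ∀ {n x} {w : State p n} → x ∈ w → count (largestDiscMove? x w) pegs ≡ 0
  largestDiscMoves-∈ x∈w = count-empty _ (λ _ move → proj₁ (avoids⇒∉ (proj₂ move)) x∈w) pegs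

  largestDiscMoves-∉ : ∀ {n x} {w : State p n} → x ∉ w →
                       count (largestDiscMove? x w) pegs ≡ p ∸ suc (occ w)
  largestDiscMoves-∉ {x = x} {w} x∉w = begin
    count (largestDiscMove? x w) pegs        ≡⟨ cong pred (sym unoccupied-split) ⟩
    pred (count (∁? (occupied? w)) pegs)     ≡⟨ cong pred (count-unoccupied w) ⟩
    pred (p ∸ occ w)                         ≡⟨ pred[m∸n]≡m∸[1+n] p (occ w) ⟩
    p ∸ suc (occ w)                          ∎
    where
    open ≡-Reasoning
    split : ∀ {k} → k ∉ w → k ≡ x ⊎ LargestDiscMove x w k
    split {k} k∉w with k ≟ x
    ... | yes k≡x = inj₁ k≡x
    ... | no k≢x  = inj₂ (k≢x ∘ sym , ∉⇒avoids x∉w k∉w)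
    join : ∀ {k} → k ≡ x ⊎ LargestDiscMove x w k → k ∉ w
    join (inj₁ refl) = x∉w
    join (inj₂ move) = proj₂ (avoids⇒∉ (proj₂ move))
    unoccupied-split : count (∁? (occupied? w)) pegs ≡ suc (count (largestDiscMove? x w) pegs)
    unoccupied-split = trans
      (count-≐ (∁? (occupied? w)) ((_≟ x) ∪? largestDiscMove? x w) (split , join) pegs)
      (trans (count-∪ (_≟ x) (largestDiscMove? x w) (λ { (refl , x≢x , _) → x≢x refl }) pegs)
             (cong (_+ count (largestDiscMove? x w) pegs) (count-allFin-≡ x)))

  count-allStates-≡ : ∀ {n} (w : State p n) → count (λ t → ≡-dec _≟_ t w) (allStates p n) ≡ 1
  count-allStates-≡ []ᵥ = refl
  count-allStates-≡ {suc n} (y ∷ᵥ w) = begin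
    count (λ t → ≡-dec _≟_ t (y ∷ᵥ w)) (allStates p (suc n))
      ≡⟨ count-concatMap-map _ (_≟ y) (λ t → ≡-dec _≟_ t w) _∷ᵥ_ ∷-injective (cong₂ _∷ᵥ_) pegs _ ⟩
    count (_≟ y) pegs * count (λ t → ≡-dec _≟_ t w) (allStates p n)
      ≡⟨ cong₂ _*_ (count-allFin-≡ y) (count-allStates-≡ w) ⟩
    1 ∎
    where open ≡-Reasoning

  deg-∷ : ∀ {n} (x : Fin p) (w : State p n) →
          deg (x ∷ᵥ w) ≡ deg w + count (largestDiscMove? x w) pegs
  deg-∷ {n} x w = begin
    deg (x ∷ᵥ w)
      ≡⟨ count-≐ (adj? (x ∷ᵥ w)) (smaller? ∪? largest?) (split , join) states ⟩
    count (smaller? ∪? largest?) states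
      ≡⟨ count-∪ smaller? largest? (λ { ((refl , _) , (x≢x , _) , _) → x≢x refl }) states ⟩
    count smaller? states + count largest? states
      ≡⟨ cong₂ _+_ (count-concatMap-map smaller? (_≟ x) (adj? w) _∷ᵥ_ (λ m → m) _,_ pegs _)
                   (count-concatMap-map largest? (largestDiscMove? x w) ≡w? _∷ᵥ_ (λ m → m) _,_ pegs _) ⟩
    count (_≟ x) pegs * deg w + moves * count ≡w? (allStates p n)
      ≡⟨ cong₂ (λ a b → a * deg w + moves * b) (count-allFin-≡ x) (count-allStates-≡ w) ⟩
    1 * deg w + moves * 1
      ≡⟨ cong₂ _+_ (+-identityʳ (deg w)) (*-identityʳ moves) ⟩
    deg w + moves ∎
    where
    open ≡-Reasoning
    states = allStates p (suc n)
    moves = count (largestDiscMove? x w) pegs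
    ≡w? : Decidable (_≡ w)
    ≡w? t = ≡-dec _≟_ t w
    MovesSmallerDisc MovesLargestDisc : State p (suc n) → Set
    MovesSmallerDisc v = head v ≡ x × Adj w (tail v)
    MovesLargestDisc v = LargestDiscMove x w (head v) × tail v ≡ w
    smaller? : Decidable MovesSmallerDisc
    smaller? v = (head v ≟ x) ×-dec adj? w (tail v)
    largest? : Decidable MovesLargestDisc
    largest? v = largestDiscMove? x w (head v) ×-dec ≡w? (tail v)
    split : ∀ {v} → Adj (x ∷ᵥ w) v → MovesSmallerDisc v ⊎ MovesLargestDisc v
    split (here x≢y avoids) = inj₂ ((x≢y , avoids) , refl)
    split (there adj) = inj₁ (refl , adj)
    join : ∀ {v} → MovesSmallerDisc v ⊎ MovesLargestDisc v → Adj (x ∷ᵥ w) v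
    join {y ∷ᵥ t} (inj₁ (refl , adj)) = there adj
    join {y ∷ᵥ t} (inj₂ ((x≢y , avoids) , refl)) = here x≢y avoids

  deg≡hanoiDegree∘occ : ∀ {n} (s : State p n) → deg s ≡ hanoiDegree p (occ s)
  deg≡hanoiDegree∘occ []ᵥ = cong (hanoiDegree p) (sym occ-[])
  deg≡hanoiDegree∘occ (x ∷ᵥ w) with occupied? w x
  ... | yes x∈w = begin
    deg (x ∷ᵥ w)                               ≡⟨ deg-∷ x w ⟩
    deg w + count (largestDiscMove? x w) pegs
      ≡⟨ cong₂ _+_ (deg≡hanoiDegree∘occ w) (largestDiscMoves-∈ x∈w) ⟩
    hanoiDegree p (occ w) + 0                  ≡⟨ +-identityʳ _ ⟩
    hanoiDegree p (occ w)                      ≡⟨ cong (hanoiDegree p) (occ-∷-∈ x∈w) ⟨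
    hanoiDegree p (occ (x ∷ᵥ w))               ∎
    where open ≡-Reasoning
  ... | no x∉w = begin
    deg (x ∷ᵥ w)                               ≡⟨ deg-∷ x w ⟩
    deg w + count (largestDiscMove? x w) pegs
      ≡⟨ cong₂ _+_ (deg≡hanoiDegree∘occ w) (largestDiscMoves-∉ x∉w) ⟩
    hanoiDegree p (suc (occ w))                ≡⟨ cong (hanoiDegree p) (occ-∷-∉ x∉w) ⟨
    hanoiDegree p (occ (x ∷ᵥ w))               ∎
    where open ≡-Reasoning

  -- Pegs in A or occupied; A absorbs the common larger discs in the induction on Adj.
  occWith : ∀ {n} {A : Fin p → Set} → Decidable A → State p n → ℕ
  occWith A? s = count (A? ∪? occupied? s) pegs

  occWith-∷ : ∀ {n} {A : Fin p → Set} (A? : Decidable A) (x : Fin p) (s : State p n) →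
              occWith A? (x ∷ᵥ s) ≡ occWith (A? ∪? (_≟ x)) s
  occWith-∷ A? x s = count-≐ _ _ (split , join) pegs
    where
    split : ∀ {k} → _ ⊎ k ∈ x ∷ᵥ s → (_ ⊎ k ≡ x) ⊎ k ∈ s
    split (inj₁ a) = inj₁ (inj₁ a)
    split (inj₂ (here k≡x)) = inj₁ (inj₂ k≡x)
    split (inj₂ (there k∈s)) = inj₂ k∈s
    join : ∀ {k} → (_ ⊎ k ≡ x) ⊎ k ∈ s → _ ⊎ k ∈ x ∷ᵥ s
    join (inj₁ (inj₁ a)) = inj₁ a
    join (inj₁ (inj₂ k≡x)) = inj₂ (here k≡x)
    join (inj₂ k∈s) = inj₂ (there k∈s)

  occWith-insert : ∀ {n} {A : Fin p → Set} (A? : Decidable A) (i : Fin p) (w : State p n) →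
                   occWith (A? ∪? (_≟ i)) w ≡ occWith A? w ⊎
                   occWith (A? ∪? (_≟ i)) w ≡ suc (occWith A? w)
  occWith-insert {A = A} A? i w with (A? ∪? occupied? w) i
  ... | yes i∈B = inj₁ (count-≐ _ _ (absorb , extend) pegs)
    where
    absorb : ∀ {k} → (A k ⊎ k ≡ i) ⊎ k ∈ w → A k ⊎ k ∈ w
    absorb (inj₁ (inj₁ a)) = inj₁ a
    absorb (inj₁ (inj₂ refl)) = i∈B
    absorb (inj₂ k∈w) = inj₂ k∈w
    extend : ∀ {k} → A k ⊎ k ∈ w → (A k ⊎ k ≡ i) ⊎ k ∈ w
    extend (inj₁ a) = inj₁ (inj₁ a)
    extend (inj₂ k∈w) = inj₂ k∈w
  ... | no i∉B = inj₂ (trans (count-≐ _ ((_≟ i) ∪? (A? ∪? occupied? w)) (split , join) pegs)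
    (trans (count-∪ (_≟ i) (A? ∪? occupied? w) (λ { (refl , i∈B) → i∉B i∈B }) pegs)
           (cong (_+ occWith A? w) (count-allFin-≡ i))))
    where
    split : ∀ {k} → (A k ⊎ k ≡ i) ⊎ k ∈ w → k ≡ i ⊎ A k ⊎ k ∈ w
    split (inj₁ (inj₁ a)) = inj₂ (inj₁ a)
    split (inj₁ (inj₂ k≡i)) = inj₁ k≡i
    split (inj₂ k∈w) = inj₂ (inj₂ k∈w)
    join : ∀ {k} → k ≡ i ⊎ A k ⊎ k ∈ w → (A k ⊎ k ≡ i) ⊎ k ∈ w
    join (inj₁ k≡i) = inj₁ (inj₂ k≡i)
    join (inj₂ (inj₁ a)) = inj₁ (inj₁ a)
    join (inj₂ (inj₂ k∈w)) = inj₂ k∈w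

  adj⇒occWith-withinOne : ∀ {n} {A : Fin p → Set} (A? : Decidable A) {s t : State p n} →
                          Adj s t → WithinOne (occWith A? s) (occWith A? t)
  adj⇒occWith-withinOne A? (there {x = x} {s} {t} adj) =
    subst₂ WithinOne (sym (occWith-∷ A? x s)) (sym (occWith-∷ A? x t))
      (adj⇒occWith-withinOne (A? ∪? (_≟ x)) adj)
  adj⇒occWith-withinOne A? (here {i = i} {j} {w} _ _)
    rewrite occWith-∷ A? i w | occWith-∷ A? j w =
    withinOne-of-extensions (occWith-insert A? i w) (occWith-insert A? j w)

  adj⇒occ-withinOne : ∀ {n} {s t : State p n} → Adj s t → WithinOne (occ s) (occ t)
  adj⇒occ-withinOne {s = s} {t} adj =
    subst₂ WithinOne (occWith-∅ s) (occWith-∅ t) (adj⇒occWith-withinOne ∅? adj)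
    where
    occWith-∅ : ∀ {n} (s : State p n) → occWith ∅? s ≡ occ s
    occWith-∅ s = count-≐ _ _ ((λ { (inj₁ ()) ; (inj₂ k∈s) → k∈s }) , inj₂) pegs

mainTheorem15 : (p n : ℕ) → 3 ≤ p → (u v : State p n) → Adj u v →
    (occ u ≡ p ⊎ occ v ≡ p) → deg u ≡ deg v
mainTheorem15 p n _ u v adj full = begin
  deg u                   ≡⟨ deg≡hanoiDegree∘occ u ⟩
  hanoiDegree p (occ u)   ≡⟨ hanoiDegree-withinOne (adj⇒occ-withinOne adj) full ⟩
  hanoiDegree p (occ v)   ≡⟨ deg≡hanoiDegree∘occ v ⟨
  deg v                   ∎
  where open ≡-Reasoning
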